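{- If $G$ is a $3$-$\gamma_{t}$-edge critical graph on $n$ vertices with (vertex) connectivity one, then $|E(G^{c})| < \left\lfloor \frac{n^{2}}{4} \right\rfloor$, where $G^{c}$ is the complement of $G$.
   Context: All graphs are finite and simple. A set $S \subseteq V(G)$ is a total dominating set of $G$ if every vertex of $G$ is adjacent to some vertex of $S$; the total domination number $\gamma_t(G)$ is the minimum size of a total dominating set (defined as $\infty$ if $G$ has isolated vertices). A graph $G$ is $3$-$\gamma_{t}$-edge critical if $\gamma_t(G) = 3$ and for every pair of nonadjacent vertices $u,v$ of $G$, $\gamma_t(G + uv) < 3$. The complement $G^{c}$ has vertex set $V(G)$, with two vertices adjacent in $G^c$ iff they are nonadjacent in $G$. -}

module Defs where

open import Data.Nat using (ℕ; zero; suc; _<_; _≤_; _+_; _/_; _*_)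
open import Data.Fin using (Fin; toℕ)
open import Data.Fin.Subset using (Subset; _∈_; ∣_∣)
open import Data.Bool using (Bool; true; false; T; not; _∨_)
open import Data.Product using (Σ; _×_; ∃)
open import Data.Sum using (_⊎_)
open import Data.List using (List; length; filter; allFin; concatMap; map)
open import Relation.Nullary using (¬_; yes; no)
open import Data.Empty using (⊥-elim)
open import Data.Unit using (⊤)
open import Relation.Binary.PropositionalEquality using (_≡_; _≢_)
open import Data.Fin.Properties using (_≟_)
open import Relation.Nullary.Decidable using (⌊_⌋)
import Data.Nat.Properties as ℕP

record Graph (n : ℕ) : Set where
  field
    adj   : Fin n → Fin n → Bool
    sym   : ∀ u v → adj u v ≡ adj v u
    irrefl : ∀ v → adj v v ≡ false
open Graph public

Adj : ∀ {n} → Graph n → Fin n → Fin n → Set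
Adj G u v = T (adj G u v)

addEdge : ∀ {n} (G : Graph n) (u v : Fin n) → u ≢ v → Graph n
addEdge {n} G u v u≢v = record
  { adj = a
  ; sym = symm
  ; irrefl = irr }
  where
  isUV : Fin n → Fin n → Bool
  isUV x y = (⌊ x ≟ u ⌋ Data.Bool.∧ ⌊ y ≟ v ⌋) ∨ (⌊ x ≟ v ⌋ Data.Bool.∧ ⌊ y ≟ u ⌋)
  a : Fin n → Fin n → Bool
  a x y = adj G x y ∨ isUV x y
  open import Data.Bool.Properties using (∨-comm)
  open import Relation.Binary.PropositionalEquality using (cong₂; refl; trans) renaming (sym to symm≡)
  isUV-sym : ∀ x y → isUV x y ≡ isUV y x
  isUV-sym x y with x ≟ u | y ≟ v | x ≟ v | y ≟ u
  ... | yes _ | yes _ | yes _ | yes _ = refl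
  ... | yes _ | yes _ | yes _ | no _ = refl
  ... | yes _ | yes _ | no _ | yes _ = refl
  ... | yes _ | yes _ | no _ | no _ = refl
  ... | yes _ | no _ | yes _ | yes _ = refl
  ... | yes _ | no _ | yes _ | no _ = refl
  ... | yes _ | no _ | no _ | yes _ = refl
  ... | yes _ | no _ | no _ | no _ = refl
  ... | no _ | yes _ | yes _ | yes _ = refl
  ... | no _ | yes _ | yes _ | no _ = refl
  ... | no _ | yes _ | no _ | yes _ = refl
  ... | no _ | yes _ | no _ | no _ = refl
  ... | no _ | no _ | yes _ | yes _ = refl
  ... | no _ | no _ | yes _ | no _ = refl
  ... | no _ | no _ | no _ | yes _ = refl
  ... | no _ | no _ | no _ | no _ = refl
  symm : ∀ x y → a x y ≡ a y x
  symm x y = cong₂ _∨_ (sym G x y) (isUV-sym x y)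
  isUV-irr : ∀ x → isUV x x ≡ false
  isUV-irr x with x ≟ u | x ≟ v
  ... | yes p | yes q = ⊥-elim (u≢v (trans (symm≡ p) q))
  ... | yes _ | no _ = refl
  ... | no _ | yes _ = refl
  ... | no _ | no _ = refl
  irr : ∀ x → a x x ≡ false
  irr x = cong₂ _∨_ (irrefl G x) (isUV-irr x)

IsTDS : ∀ {n} → Graph n → Subset n → Set
IsTDS G S = ∀ v → ∃ λ w → w ∈ S × Adj G v w

-- γ_t(G) = k  (k a natural number; graphs with isolated vertices have
-- γ_t = ∞ and so never satisfy this).
TotalDomNumberIs : ∀ {n} → Graph n → ℕ → Set
TotalDomNumberIs G k =
  (Σ (Subset _) λ S → IsTDS G S × ∣ S ∣ ≡ k) ×
  (∀ S → IsTDS G S → k ≤ ∣ S ∣)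

TotalDomNumberLt : ∀ {n} → Graph n → ℕ → Set
TotalDomNumberLt G k = Σ (Subset _) λ S → IsTDS G S × ∣ S ∣ < k

ThreeTotalEdgeCritical : ∀ {n} → Graph n → Set
ThreeTotalEdgeCritical G =
  TotalDomNumberIs G 3 ×
  (∀ u v (u≢v : u ≢ v) → ¬ Adj G u v → TotalDomNumberLt (addEdge G u v u≢v) 3)

data WalkAvoiding {n} (G : Graph n) (P : Fin n → Set) : Fin n → Fin n → Set where
  here : ∀ {x} → P x → WalkAvoiding G P x x
  step : ∀ {x y w} → P x → Adj G x y → WalkAvoiding G P y w → WalkAvoiding G P x w

Connected : ∀ {n} → Graph n → Set
Connected G = ∀ x y → WalkAvoiding G (λ _ → ⊤) x y

CutVertex : ∀ {n} → Graph n → Fin n → Set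
CutVertex G z = ∃ λ x → ∃ λ y → x ≢ z × y ≢ z × ¬ WalkAvoiding G (λ w → w ≢ z) x y

-- Vertex connectivity κ(G) = 1: G is connected, not K_1 (κ(K_1)=0), and either
-- has a cut vertex or is K_2 (κ(K_n) = n - 1 convention).
ConnectivityOne : ∀ {n} → Graph n → Set
ConnectivityOne {n} G = Connected G × 2 ≤ n × ((∃ λ z → CutVertex G z) ⊎ n ≡ 2)

complementEdgeCount : ∀ {n} → Graph n → ℕ
complementEdgeCount {n} G =
  length (filter (λ p → ⌊ toℕ (Data.Product.proj₁ p) ℕP.<? toℕ (Data.Product.proj₂ p) ⌋ Data.Bool.∧ not (adj G (Data.Product.proj₁ p) (Data.Product.proj₂ p)) Data.Bool.≟ true)
    (concatMap (λ i → map (λ j → (i Data.Product., j)) (allFin n)) (allFin n)))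

-- Criticality gives two facts: no two vertices dominate G, but for every non-edge uv some
-- pair dominates G + uv. Let c be a cut vertex. Some vertex misses c (else c and a neighbour
-- of c would dominate), and comparing dominating pairs of G + uv for u, v on the two sides of c
-- shows that c has a leaf neighbour v. With such a leaf, the remaining vertices split into the
-- neighbours (Near) and non-neighbours (Far) of c; criticality makes both cliques with at least
-- two vertices, and lets each Near vertex miss at most one Far vertex. So every non-edge can be
-- charged to one of the n - 2 vertices other than c and v, each receiving at most two charges,
-- and G^c has at most 2(n - 2) edges; as n ≥ 6 this is less than ⌊n²/4⌋.
module Submission where

open import Data.Bool using (true; false; T; not; _∧_)
import Data.Bool as Bool
open import Data.Bool.Properties using (T-∧; T-∨)
open import Data.Empty using (⊥; ⊥-elim)
open import Data.Fin using (Fin; toℕ) renaming (zero to fzero; suc to fsuc)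
open import Data.Fin.Properties using (_≟_; suc-injective; any?)
open import Data.Fin.Subset using (Subset; _∈_; _∉_; ∣_∣; ⁅_⁆; _∪_; inside; outside)
open import Data.Fin.Subset.Properties using (x∈⁅x⁆; x∈p∪q⁺; ∣⁅x⁆∣≡1; ∣p∣≤n)
open import Data.List using (List; length; filter; tabulate; concatMap; map; allFin; _++_)
open import Data.List.Properties using (filter-++; length-++; map-tabulate)
open import Data.Nat using (ℕ; zero; suc; _+_; _*_; _/_; _≤_; _<_; z≤n; s≤s)
import Data.Nat.Properties as ℕ
open import Algebra.Properties.CommutativeMonoid.Sum ℕ.+-0-commutativeMonoid
  using (sum; sum-syntax; ∑-distrib-+; ∑-comm; sum-cong-≗)
open import Data.Nat.DivMod using (m*n/n≡m; /-monoˡ-≤)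
open import Data.Nat.Solver using (module +-*-Solver)
open import Data.Product using (∃; ∃₂; _×_; _,_; proj₁; proj₂)
import Data.Product as Product
open import Data.Sum using (_⊎_; inj₁; inj₂; [_,_])
import Data.Sum as Sum
open import Data.Unit using (⊤; tt)
open import Data.Vec using ([]; _∷_; here; there)
open import Function using (_∘_; id)
open import Function.Bundles using (Equivalence)
open import Level using (Level)
open import Relation.Binary.PropositionalEquality
  using (_≡_; _≢_; refl; sym; cong; cong₂; subst; module ≡-Reasoning)
open import Relation.Nullary
open import Relation.Nullary.Decidable
  using (T?; ¬?; _×-dec_; _⊎-dec_; ⌊_⌋; toWitness; decidable-stable)
open import Relation.Unary using (Pred; Decidable; _⊆_)

open import Defs renaming (sym to adj-sym; irrefl to adj-irrefl)

private
  variable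
    ℓ₁ ℓ₂ ℓ₃ : Level
    A : Set ℓ₁
    B : Set ℓ₂
    C : Set ℓ₃
    n : ℕ
    P : Pred (Fin n) ℓ₁
    Q : Pred (Fin n) ℓ₂
    R : Pred (Fin n) ℓ₃

-- Counting

𝟙 : Dec A → ℕ
𝟙 (true because _)  = 1
𝟙 (false because _) = 0

𝟙-mono : (A? : Dec A) (B? : Dec B) → (A → B) → 𝟙 A? ≤ 𝟙 B?
𝟙-mono (no _)  _       _   = z≤n
𝟙-mono (yes _) (yes _) _   = ℕ.≤-refl
𝟙-mono (yes x) (no ¬y) A⇒B = contradiction (A⇒B x) ¬y

𝟙-⊎ : (A? : Dec A) (B? : Dec B) (C? : Dec C) → (A → B ⊎ C) → 𝟙 A? ≤ 𝟙 B? + 𝟙 C?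
𝟙-⊎ (no _)  _       _       _ = z≤n
𝟙-⊎ (yes _) (yes _) _       _ = s≤s z≤n
𝟙-⊎ (yes _) (no _)  (yes _) _ = ℕ.≤-refl
𝟙-⊎ (yes x) (no ¬y) (no ¬z) f = ⊥-elim ([ ¬y , ¬z ] (f x))

𝟙-disjoint : (A? : Dec A) (B? : Dec B) (C? : Dec C) →
             (A → C) → (B → C) → (A → B → ⊥) → 𝟙 A? + 𝟙 B? ≤ 𝟙 C?
𝟙-disjoint (yes x) (yes y) _       _   _   A∩B = ⊥-elim (A∩B x y)
𝟙-disjoint (yes _) (no _)  (yes _) _   _   _   = ℕ.≤-refl
𝟙-disjoint (yes x) (no _)  (no ¬z) A⇒C _   _   = contradiction (A⇒C x) ¬z
𝟙-disjoint (no _)  (yes _) (yes _) _   _   _   = ℕ.≤-refl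
𝟙-disjoint (no _)  (yes y) (no ¬z) _   B⇒C _   = contradiction (B⇒C y) ¬z
𝟙-disjoint (no _)  (no _)  _       _   _   _   = z≤n

∑-mono-≤ : ∀ {n} {f g : Fin n → ℕ} → (∀ i → f i ≤ g i) → sum f ≤ sum g
∑-mono-≤ {zero}  _   = z≤n
∑-mono-≤ {suc n} f≤g = ℕ.+-mono-≤ (f≤g fzero) (∑-mono-≤ (f≤g ∘ fsuc))

term≤∑ : ∀ {n} (f : Fin n → ℕ) i → f i ≤ sum f
term≤∑ f fzero    = ℕ.m≤m+n _ _
term≤∑ f (fsuc i) = ℕ.≤-trans (term≤∑ (f ∘ fsuc) i) (ℕ.m≤n+m _ _)

count : ∀ {n} {P : Pred (Fin n) ℓ₁} → Decidable P → ℕ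
count {n = n} P? = ∑[ i < n ] 𝟙 (P? i)

count-⊎ : (P? : Decidable P) (Q? : Decidable Q) (R? : Decidable R) → (∀ {i} → P i → Q i ⊎ R i) →
          count P? ≤ count Q? + count R?
count-⊎ P? Q? R? P⊆Q∪R = ℕ.≤-trans (∑-mono-≤ λ i → 𝟙-⊎ (P? i) (Q? i) (R? i) P⊆Q∪R)
                                (ℕ.≤-reflexive (∑-distrib-+ (𝟙 ∘ Q?) (𝟙 ∘ R?)))

count-disjoint : (P? : Decidable P) (Q? : Decidable Q) (R? : Decidable R) → P ⊆ R → Q ⊆ R →
                 (∀ {i} → P i → Q i → ⊥) → count P? + count Q? ≤ count R?
count-disjoint P? Q? R? P⊆R Q⊆R P∩Q =
  ℕ.≤-trans (ℕ.≤-reflexive (sym (∑-distrib-+ (𝟙 ∘ P?) (𝟙 ∘ Q?))))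
  (∑-mono-≤ λ i → 𝟙-disjoint (P? i) (Q? i) (R? i) P⊆R Q⊆R P∩Q)

count-≥1 : (P? : Decidable P) → ∀ {i} → P i → 1 ≤ count P?
count-≥1 P? {i} pᵢ = ℕ.≤-trans (𝟙-mono (yes pᵢ) (P? i) λ _ → pᵢ) (term≤∑ (𝟙 ∘ P?) i)

count-none : ∀ {n} {P : Pred (Fin n) ℓ₁} (P? : Decidable P) → (∀ i → ¬ P i) → count P? ≡ 0
count-none {n = zero}  P? ¬P = refl
count-none {n = suc n} P? ¬P with P? fzero
... | yes p₀ = contradiction p₀ (¬P fzero)
... | no _   = count-none (P? ∘ fsuc) (¬P ∘ fsuc)

count-full : ∀ {n} {P : Pred (Fin n) ℓ₁} (P? : Decidable P) → (∀ i → P i) → count P? ≡ n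
count-full {n = zero}  P? all = refl
count-full {n = suc n} P? all with P? fzero
... | yes _  = cong suc (count-full (P? ∘ fsuc) (all ∘ fsuc))
... | no ¬p₀ = contradiction (all fzero) ¬p₀

count-≤1 : ∀ {n} {P : Pred (Fin n) ℓ₁} (P? : Decidable P) →
           (∀ {i j} → P i → P j → i ≡ j) → count P? ≤ 1
count-≤1 {n = zero}  P? unique = z≤n
count-≤1 {n = suc n} P? unique with P? fzero
... | yes p₀ = ℕ.≤-reflexive (cong suc (count-none (P? ∘ fsuc) λ i pᵢ → 0≢suc (unique p₀ pᵢ)))
  where
  0≢suc : ∀ {i : Fin n} → fzero ≢ fsuc i
  0≢suc ()
... | no _   = count-≤1 (P? ∘ fsuc) λ pᵢ pⱼ → suc-injective (unique pᵢ pⱼ)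

count-≥2 : (P? : Decidable P) →
           ∀ {i j} → P i → P j → i ≢ j → 2 ≤ count P?
count-≥2 P? {i} {j} pᵢ pⱼ i≢j = ℕ.≤-trans
  (ℕ.+-mono-≤ (count-≥1 (_≟ i) refl) (count-≥1 (_≟ j) refl))
  (count-disjoint (_≟ i) (_≟ j) P? (λ { refl → pᵢ }) (λ { refl → pⱼ }) λ { refl refl → i≢j refl })

module _ {A : Set ℓ₁} {P : Pred A ℓ₂} (P? : Decidable P) where

  length-filter-tabulate : ∀ {n} (f : Fin n → A) →
                           length (filter P? (tabulate f)) ≡ ∑[ i < n ] 𝟙 (P? (f i))
  length-filter-tabulate {n = zero}  f = refl
  length-filter-tabulate {n = suc n} f with P? (f fzero)
  ... | yes _ = cong suc (length-filter-tabulate (f ∘ fsuc))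
  ... | no _  = length-filter-tabulate (f ∘ fsuc)

  length-filter-concatMap : ∀ {n} (g : B → List A) (f : Fin n → B) →
    length (filter P? (concatMap g (tabulate f))) ≡ ∑[ i < n ] length (filter P? (g (f i)))
  length-filter-concatMap {n = zero}  g f = refl
  length-filter-concatMap {n = suc n} g f = begin
    length (filter P? (g (f fzero) ++ concatMap g (tabulate (f ∘ fsuc))))
      ≡⟨ cong length (filter-++ P? (g (f fzero)) _) ⟩
    length (filter P? (g (f fzero)) ++ filter P? (concatMap g (tabulate (f ∘ fsuc))))
      ≡⟨ length-++ (filter P? (g (f fzero))) ⟩
    length (filter P? (g (f fzero))) + length (filter P? (concatMap g (tabulate (f ∘ fsuc))))
      ≡⟨ cong (length (filter P? (g (f fzero))) +_) (length-filter-concatMap g (f ∘ fsuc)) ⟩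
    ∑[ i < suc n ] length (filter P? (g (f i))) ∎
    where open ≡-Reasoning

module _ {n} (G : Graph n) where

  NonEdge? : ∀ i j → Dec (toℕ i < toℕ j × ¬ Adj G i j)
  NonEdge? i j = toℕ i ℕ.<? toℕ j ×-dec ¬? (T? (adj G i j))

  complementEdgeCount≡∑ : complementEdgeCount G ≡ ∑[ i < n ] count (NonEdge? i)
  complementEdgeCount≡∑ = begin
    complementEdgeCount G
      ≡⟨ length-filter-concatMap isNonEdge? (λ i → map (i ,_) (allFin n)) id ⟩
    ∑[ i < n ] length (filter isNonEdge? (map (i ,_) (allFin n)))
      ≡⟨ sum-cong-≗ (λ i → cong (length ∘ filter isNonEdge?) (map-tabulate id (i ,_))) ⟩
    ∑[ i < n ] length (filter isNonEdge? (tabulate (i ,_)))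
      ≡⟨ sum-cong-≗ (λ i → length-filter-tabulate isNonEdge? (i ,_)) ⟩
    ∑[ i < n ] ∑[ j < n ] 𝟙 (isNonEdge? (i , j))
      ≡⟨ sum-cong-≗ (λ i → sum-cong-≗ (𝟙-isNonEdge i)) ⟩
    ∑[ i < n ] count (NonEdge? i) ∎
    where
    open ≡-Reasoning
    nonEdgeᵇ : Fin n × Fin n → Bool.Bool
    nonEdgeᵇ e = ⌊ toℕ (proj₁ e) ℕ.<? toℕ (proj₂ e) ⌋ ∧ not (adj G (proj₁ e) (proj₂ e))
    isNonEdge? : ∀ e → Dec (nonEdgeᵇ e ≡ true)
    isNonEdge? e = nonEdgeᵇ e Bool.≟ true
    -- `⌊_⌋` only computes on a decision in canonical form, hence the case split.
    𝟙-isNonEdge : ∀ i j → 𝟙 (isNonEdge? (i , j)) ≡ 𝟙 (NonEdge? i j)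
    𝟙-isNonEdge i j with toℕ i ℕ.<? toℕ j | adj G i j
    ... | yes _ | true  = refl
    ... | yes _ | false = refl
    ... | no _  | _     = refl

module _ {n} {R : Fin n → Fin n → Set ℓ₁} {C : Fin n → Fin n → Set ℓ₂}
         (R? : ∀ i j → Dec (R i j)) (C? : ∀ i j → Dec (C i j)) where

  count-oriented : (∀ {i j} → toℕ i < toℕ j → R i j → C i j ⊎ C j i) →
    ∑[ i < n ] count (λ j → toℕ i ℕ.<? toℕ j ×-dec R? i j) ≤ ∑[ i < n ] count (C? i)
  count-oriented orient = begin
    ∑[ i < n ] ∑[ j < n ] below R? i j
      ≤⟨ ∑-mono-≤ (λ i → ∑-mono-≤ λ j → 𝟙-⊎ (lt? i j ×-dec R? i j) (lt? i j ×-dec C? i j)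
           (lt? i j ×-dec C? j i) λ (i<j , r) → Sum.map (i<j ,_) (i<j ,_) (orient i<j r)) ⟩
    ∑[ i < n ] ∑[ j < n ] (below C? i j + below C?ᵀ i j)
      ≡⟨ sum-cong-≗ (λ i → ∑-distrib-+ (below C? i) (below C?ᵀ i)) ⟩
    ∑[ i < n ] (∑[ j < n ] below C? i j + ∑[ j < n ] below C?ᵀ i j)
      ≡⟨ ∑-distrib-+ (λ i → ∑[ j < n ] below C? i j) (λ i → ∑[ j < n ] below C?ᵀ i j) ⟩
    ∑[ i < n ] ∑[ j < n ] below C? i j + ∑[ i < n ] ∑[ j < n ] below C?ᵀ i j
      ≡⟨ cong (∑[ i < n ] ∑[ j < n ] below C? i j +_) (∑-comm (below C?ᵀ)) ⟩
    ∑[ i < n ] ∑[ j < n ] below C? i j + ∑[ i < n ] ∑[ j < n ] below C?ᵀ j i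
      ≡⟨ sym (∑-distrib-+ (λ i → ∑[ j < n ] below C? i j) (λ i → ∑[ j < n ] below C?ᵀ j i)) ⟩
    ∑[ i < n ] (∑[ j < n ] below C? i j + ∑[ j < n ] below C?ᵀ j i)
      ≡⟨ sum-cong-≗ (λ i → sym (∑-distrib-+ (below C? i) (λ j → below C?ᵀ j i))) ⟩
    ∑[ i < n ] ∑[ j < n ] (below C? i j + below C?ᵀ j i)
      ≤⟨ ∑-mono-≤ (λ i → ∑-mono-≤ λ j → 𝟙-disjoint (lt? i j ×-dec C? i j) (lt? j i ×-dec C? i j)
           (C? i j) proj₂ proj₂ λ (i<j , _) (j<i , _) → ℕ.<-asym i<j j<i) ⟩
    ∑[ i < n ] count (C? i) ∎
    where
    open ℕ.≤-Reasoning
    lt? : ∀ i j → Dec (toℕ i < toℕ j)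
    lt? i j = toℕ i ℕ.<? toℕ j
    below : ∀ {ℓ} {X : Fin n → Fin n → Set ℓ} → (∀ i j → Dec (X i j)) → Fin n → Fin n → ℕ
    below X? i j = 𝟙 (lt? i j ×-dec X? i j)
    C?ᵀ : ∀ i j → Dec (C j i)
    C?ᵀ i j = C? j i

≤2a⇒<n²/4 : ∀ {n k a} → k ≤ a + a → a + 2 ≤ n → 4 ≤ a → k < n * n / 4
≤2a⇒<n²/4 {n} {k} {a} k≤2a a+2≤n 4≤a = begin
  suc k          ≡⟨ sym (m*n/n≡m (suc k) 4) ⟩
  suc k * 4 / 4  ≤⟨ /-monoˡ-≤ 4 4[k+1]≤n² ⟩
  n * n / 4      ∎
  where
  open ℕ.≤-Reasoning
  open +-*-Solver
  4[k+1]≤n² : suc k * 4 ≤ n * n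
  4[k+1]≤n² = begin
    suc k * 4              ≤⟨ ℕ.*-monoˡ-≤ 4 (s≤s k≤2a) ⟩
    suc (a + a) * 4        ≡⟨ solve 1 (λ a → (con 1 :+ (a :+ a)) :* con 4
                                           := con 4 :* a :+ con 4 :* a :+ con 4) refl a ⟩
    4 * a + 4 * a + 4      ≤⟨ ℕ.+-monoˡ-≤ 4 (ℕ.+-monoˡ-≤ (4 * a) (ℕ.*-monoˡ-≤ a 4≤a)) ⟩
    a * a + 4 * a + 4      ≡⟨ solve 1 (λ a → a :* a :+ con 4 :* a :+ con 4
                                           := (a :+ con 2) :* (a :+ con 2)) refl a ⟩
    (a + 2) * (a + 2)      ≤⟨ ℕ.*-mono-≤ a+2≤n a+2≤n ⟩
    n * n                  ∎

-- Domination and total dominating sets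

Dominates : ∀ {n} → (Fin n → Fin n → Set) → Fin n → Fin n → Set
Dominates _∼_ p q = ∀ w → w ∼ p ⊎ w ∼ q

module _ {n} {R : Fin n → Fin n → Set} where

  Dominates-swap : ∀ {p q} → Dominates R p q → Dominates R q p
  Dominates-swap dom = Sum.swap ∘ dom

  Dominates-through : ∀ {p q} → Dominates R p q → ∀ w → ∃₂ λ r s → Dominates R r s × R w r
  Dominates-through {p} {q} dom w with dom w
  ... | inj₁ w∼p = p , q , dom , w∼p
  ... | inj₂ w∼q = q , p , Dominates-swap dom , w∼q

Adj⁺ : ∀ {n} → Graph n → Fin n → Fin n → Fin n → Fin n → Set
Adj⁺ G u v a b = Adj G a b ⊎ (a ≡ u × b ≡ v) ⊎ (a ≡ v × b ≡ u)

Adj-addEdge : ∀ {n} (G : Graph n) {u v} (u≢v : u ≢ v) {a b} →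
              Adj (addEdge G u v u≢v) a b → Adj⁺ G u v a b
Adj-addEdge G u≢v =
  Sum.map id (Sum.map endpoints endpoints ∘ Equivalence.to T-∨) ∘ Equivalence.to T-∨
  where
  endpoints : ∀ {x y x′ y′} → T (⌊ x ≟ x′ ⌋ ∧ ⌊ y ≟ y′ ⌋) → x ≡ x′ × y ≡ y′
  endpoints {x} {y} {x′} {y′} =
    Product.map toWitness toWitness ∘ Equivalence.to (T-∧ {⌊ x ≟ x′ ⌋} {⌊ y ≟ y′ ⌋})

module Adjacency {n} (G : Graph n) where

  Adj-sym : ∀ {a b} → Adj G a b → Adj G b a
  Adj-sym {a} {b} = subst T (adj-sym G a b)

  Adj-irrefl : ∀ {a} → ¬ Adj G a a
  Adj-irrefl {a} = subst T (adj-irrefl G a)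

  Adj⇒≢ : ∀ {a b} → Adj G a b → a ≢ b
  Adj⇒≢ a∼b refl = Adj-irrefl a∼b

  Adj? : ∀ a b → Dec (Adj G a b)
  Adj? a b = T? (adj G a b)

  module _ {u v : Fin n} where

    Adj⁺-swap : ∀ {a b} → Adj⁺ G u v a b → Adj⁺ G v u a b
    Adj⁺-swap = Sum.map₂ Sum.swap

    Adj⁺-sym : ∀ {a b} → Adj⁺ G u v a b → Adj⁺ G u v b a
    Adj⁺-sym = Sum.map Adj-sym (Sum.swap ∘ Sum.map Product.swap Product.swap)

    Adj⁺⇒Adjˡ : ∀ {a b} → Adj⁺ G u v a b → a ≢ u → a ≢ v → Adj G a b
    Adj⁺⇒Adjˡ (inj₁ a∼b)            _   _   = a∼b
    Adj⁺⇒Adjˡ (inj₂ (inj₁ (a≡u , _))) a≢u _   = contradiction a≡u a≢u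
    Adj⁺⇒Adjˡ (inj₂ (inj₂ (a≡v , _))) _   a≢v = contradiction a≡v a≢v

    Adj⁺⇒Adjʳ : ∀ {a b} → Adj⁺ G u v a b → b ≢ u → b ≢ v → Adj G a b
    Adj⁺⇒Adjʳ (inj₁ a∼b)            _   _   = a∼b
    Adj⁺⇒Adjʳ (inj₂ (inj₁ (_ , b≡v))) _   b≢v = contradiction b≡v b≢v
    Adj⁺⇒Adjʳ (inj₂ (inj₂ (_ , b≡u))) b≢u _   = contradiction b≡u b≢u

    Adj⁺-irrefl : u ≢ v → ∀ {a} → ¬ Adj⁺ G u v a a
    Adj⁺-irrefl _   (inj₁ a∼a)                = Adj-irrefl a∼a
    Adj⁺-irrefl u≢v (inj₂ (inj₁ (refl , refl))) = u≢v refl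
    Adj⁺-irrefl u≢v (inj₂ (inj₂ (refl , refl))) = u≢v refl

∣p∪q∣≤∣p∣+∣q∣ : ∀ {n} (p q : Subset n) → ∣ p ∪ q ∣ ≤ ∣ p ∣ + ∣ q ∣
∣p∪q∣≤∣p∣+∣q∣ []            []            = z≤n
∣p∪q∣≤∣p∣+∣q∣ (inside ∷ p)  (inside ∷ q)  =
  s≤s (ℕ.≤-trans (ℕ.m≤n⇒m≤1+n (∣p∪q∣≤∣p∣+∣q∣ p q)) (ℕ.≤-reflexive (sym (ℕ.+-suc ∣ p ∣ ∣ q ∣))))
∣p∪q∣≤∣p∣+∣q∣ (inside ∷ p)  (outside ∷ q) = s≤s (∣p∪q∣≤∣p∣+∣q∣ p q)
∣p∪q∣≤∣p∣+∣q∣ (outside ∷ p) (inside ∷ q)  =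
  ℕ.≤-trans (s≤s (∣p∪q∣≤∣p∣+∣q∣ p q)) (ℕ.≤-reflexive (sym (ℕ.+-suc ∣ p ∣ ∣ q ∣)))
∣p∪q∣≤∣p∣+∣q∣ (outside ∷ p) (outside ∷ q) = ∣p∪q∣≤∣p∣+∣q∣ p q

∣p∣≡0⇒x∉p : ∀ {n} (p : Subset n) → ∣ p ∣ ≡ 0 → ∀ {x} → x ∉ p
∣p∣≡0⇒x∉p (inside ∷ p)  ()
∣p∣≡0⇒x∉p (outside ∷ p) ∣p∣≡0 (there x∈p) = ∣p∣≡0⇒x∉p p ∣p∣≡0 x∈p

∣p∣≤1⇒⊆⁅x⁆ : ∀ {n} (p : Subset (suc n)) → ∣ p ∣ ≤ 1 → ∃ λ x → ∀ {w} → w ∈ p → w ≡ x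
∣p∣≤1⇒⊆⁅x⁆ (inside ∷ p) (s≤s ∣p∣≤0) =
  fzero , λ { here → refl ; (there w∈p) → contradiction w∈p (∣p∣≡0⇒x∉p p (ℕ.n≤0⇒n≡0 ∣p∣≤0)) }
∣p∣≤1⇒⊆⁅x⁆ {zero}  (outside ∷ []) _ = fzero , λ { (there ()) }
∣p∣≤1⇒⊆⁅x⁆ {suc n} (outside ∷ p) ∣p∣≤1 with ∣p∣≤1⇒⊆⁅x⁆ p ∣p∣≤1
... | x , p⊆⁅x⁆ = fsuc x , λ { (there w∈p) → cong fsuc (p⊆⁅x⁆ w∈p) }

∣p∣≤2⇒⊆⁅x,y⁆ : ∀ {n} (p : Subset (suc n)) → ∣ p ∣ ≤ 2 → ∃₂ λ x y → ∀ {w} → w ∈ p → w ≡ x ⊎ w ≡ y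
∣p∣≤2⇒⊆⁅x,y⁆ {zero}  (inside ∷ [])  _ = fzero , fzero , λ { here → inj₁ refl }
∣p∣≤2⇒⊆⁅x,y⁆ {zero}  (outside ∷ []) _ = fzero , fzero , λ { (there ()) }
∣p∣≤2⇒⊆⁅x,y⁆ {suc n} (inside ∷ p) (s≤s ∣p∣≤1) with ∣p∣≤1⇒⊆⁅x⁆ p ∣p∣≤1
... | x , p⊆⁅x⁆ =
  fzero , fsuc x , λ { here → inj₁ refl ; (there w∈p) → inj₂ (cong fsuc (p⊆⁅x⁆ w∈p)) }
∣p∣≤2⇒⊆⁅x,y⁆ {suc n} (outside ∷ p) ∣p∣≤2 with ∣p∣≤2⇒⊆⁅x,y⁆ p ∣p∣≤2
... | x , y , p⊆⁅x,y⁆ =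
  fsuc x , fsuc y , λ { (there w∈p) → Sum.map (cong fsuc) (cong fsuc) (p⊆⁅x,y⁆ w∈p) }

module _ {n} (G : Graph n) where

  Dominates⇒IsTDS : ∀ {p q} → Dominates (Adj G) p q → IsTDS G (⁅ p ⁆ ∪ ⁅ q ⁆)
  Dominates⇒IsTDS {p} {q} dom w with dom w
  ... | inj₁ w∼p = p , x∈p∪q⁺ (inj₁ (x∈⁅x⁆ p)) , w∼p
  ... | inj₂ w∼q = q , x∈p∪q⁺ {p = ⁅ p ⁆} (inj₂ (x∈⁅x⁆ q)) , w∼q

  γt≡3⇒¬Dominates : TotalDomNumberIs G 3 → ∀ p q → ¬ Dominates (Adj G) p q
  γt≡3⇒¬Dominates (_ , minimal) p q dom = ℕ.<⇒≱ ∣⁅p⁆∪⁅q⁆∣<3 (minimal _ (Dominates⇒IsTDS dom))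
    where
    ∣⁅p⁆∪⁅q⁆∣<3 : ∣ ⁅ p ⁆ ∪ ⁅ q ⁆ ∣ < 3
    ∣⁅p⁆∪⁅q⁆∣<3 = s≤s (ℕ.≤-trans (∣p∪q∣≤∣p∣+∣q∣ ⁅ p ⁆ ⁅ q ⁆)
                                (ℕ.≤-reflexive (cong₂ _+_ (∣⁅x⁆∣≡1 p) (∣⁅x⁆∣≡1 q))))

  γt≡k⇒k≤n : ∀ {k} → TotalDomNumberIs G k → k ≤ n
  γt≡k⇒k≤n ((S , _ , ∣S∣≡k) , _) = subst (_≤ n) ∣S∣≡k (∣p∣≤n S)

  γt≡k⇒neighbour : ∀ {k} → TotalDomNumberIs G k → ∀ w → ∃ (Adj G w)
  γt≡k⇒neighbour ((_ , S-dominates , _) , _) w = Product.map₂ proj₂ (S-dominates w)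

IsTDS⇒Dominates : ∀ {n} (G : Graph (suc n)) {S} → IsTDS G S → ∣ S ∣ < 3 → ∃₂ (Dominates (Adj G))
IsTDS⇒Dominates G {S} S-dominates (s≤s ∣S∣≤2) with ∣p∣≤2⇒⊆⁅x,y⁆ S ∣S∣≤2
... | p , q , S⊆⁅p,q⁆ = p , q , λ w → dominator w (S-dominates w)
  where
  dominator : ∀ w → (∃ λ z → z ∈ S × Adj G w z) → Adj G w p ⊎ Adj G w q
  dominator w (z , z∈S , w∼z) with S⊆⁅p,q⁆ z∈S
  ... | inj₁ refl = inj₁ w∼z
  ... | inj₂ refl = inj₂ w∼z

critical⇒Dominates⁺ : ∀ {n} {G : Graph (suc n)} → ThreeTotalEdgeCritical G →
  ∀ {u v} → u ≢ v → ¬ Adj G u v → ∃₂ (Dominates (Adj⁺ G u v))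
critical⇒Dominates⁺ {G = G} (_ , critical) u≢v u≁v
  with S , S-dominates , ∣S∣<3 ← critical _ _ u≢v u≁v
  with p , q , dom ← IsTDS⇒Dominates (addEdge G _ _ u≢v) S-dominates ∣S∣<3
  = p , q , Sum.map (Adj-addEdge G u≢v) (Adj-addEdge G u≢v) ∘ dom

-- Separations at a cut vertex

module _ {n} {G : Graph n} {P : Fin n → Set} where

  WalkAvoiding-end : ∀ {a b} → WalkAvoiding G P a b → P b
  WalkAvoiding-end (here Pa)       = Pa
  WalkAvoiding-end (step _ _ walk) = WalkAvoiding-end walk

  WalkAvoiding-snoc : ∀ {a b d} → WalkAvoiding G P a b → Adj G b d → P d → WalkAvoiding G P a d
  WalkAvoiding-snoc (here Pa)           b∼d Pd = step Pa b∼d (here Pd)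
  WalkAvoiding-snoc (step Pa a∼x walk) b∼d Pd = step Pa a∼x (WalkAvoiding-snoc walk b∼d Pd)

ClosedAwayFrom : ∀ {n} → Graph n → (Fin n → Set) → Fin n → Set
ClosedAwayFrom G P c = ∀ {x y} → P x → Adj G x y → y ≢ c → P y

closed-walk-reaches : ∀ {n} {G : Graph n} {P Q : Fin n → Set} {a c} → ClosedAwayFrom G P c →
                      P a → ¬ P c → WalkAvoiding G Q a c → ∃ λ w → P w × Adj G w c
closed-walk-reaches closed Pa ¬Pc (here _) = contradiction Pa ¬Pc
closed-walk-reaches {c = c} closed Pa ¬Pc (step {y = b} _ a∼b walk) with b ≟ c
... | yes refl = _ , Pa , a∼b
... | no b≢c   = closed-walk-reaches closed (closed Pa a∼b b≢c) ¬Pc walk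

Leaf : ∀ {n} → Graph n → Fin n → Set
Leaf G c = ∃ λ v → Adj G v c × (∀ {z} → Adj G v z → z ≡ c)

-- The sides cover G - c only up to double negation, as reachability in G - c is not decided.
record Separation {n} (G : Graph n) (c : Fin n) : Set₁ where
  field
    Side₁ Side₂ : Fin n → Set
    closed₁     : ClosedAwayFrom G Side₁ c
    closed₂     : ClosedAwayFrom G Side₂ c
    disjoint    : ∀ {w} → Side₁ w → ¬ Side₂ w
    covers      : ∀ {w} → w ≢ c → ¬ ¬ (Side₁ w ⊎ Side₂ w)
    c∉Side₁     : ¬ Side₁ c
    c∉Side₂     : ¬ Side₂ c
    inhabited₁  : ∃ Side₁
    inhabited₂  : ∃ Side₂

Separation-swap : ∀ {n} {G : Graph n} {c} → Separation G c → Separation G c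
Separation-swap σ = record
  { Side₁ = Side₂ ; Side₂ = Side₁ ; closed₁ = closed₂ ; closed₂ = closed₁
  ; disjoint = λ s₂ s₁ → disjoint s₁ s₂ ; covers = λ w≢c ¬sides → covers w≢c (¬sides ∘ Sum.swap)
  ; c∉Side₁ = c∉Side₂ ; c∉Side₂ = c∉Side₁ ; inhabited₁ = inhabited₂ ; inhabited₂ = inhabited₁ }
  where open Separation σ

separation-at-cut : ∀ {n} {G : Graph n} {c} → CutVertex G c → Separation G c
separation-at-cut {n} {G} {c} (x , y , x≢c , y≢c , x↮y) = record
  { Side₁      = Side₁
  ; Side₂      = λ w → w ≢ c × ¬ Side₁ w
  ; closed₁    = WalkAvoiding-snoc
  ; closed₂    = λ (a≢c , a∉Side₁) a∼b b≢c →
                   b≢c , λ b∈Side₁ → a∉Side₁ (WalkAvoiding-snoc b∈Side₁ (Adj-sym a∼b) a≢c)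
  ; disjoint   = λ s₁ s₂ → proj₂ s₂ s₁
  ; covers     = λ w≢c ¬sides → ¬sides (inj₂ (w≢c , ¬sides ∘ inj₁))
  ; c∉Side₁    = λ walk → WalkAvoiding-end walk refl
  ; c∉Side₂    = λ (c≢c , _) → c≢c refl
  ; inhabited₁ = x , here x≢c
  ; inhabited₂ = y , y≢c , x↮y
  }
  where
  open Adjacency G using (Adj-sym)
  Side₁ : Fin n → Set
  Side₁ = WalkAvoiding G (_≢ c) x

module SeparationProperties {n} {G : Graph n} {c} (σ : Separation G c) where
  open Separation σ

  no-cross-edge : ∀ {a b} → Side₁ a → Side₂ b → ¬ Adj G a b
  no-cross-edge a∈₁ b∈₂ a∼b = disjoint (closed₁ a∈₁ a∼b λ { refl → c∉Side₂ b∈₂ }) b∈₂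

  Side₁≢Side₂ : ∀ {a b} → Side₁ a → Side₂ b → a ≢ b
  Side₁≢Side₂ a∈₁ a∈₂ refl = disjoint a∈₁ a∈₂

  Side₁⇒≢c : ∀ {a} → Side₁ a → a ≢ c
  Side₁⇒≢c a∈₁ refl = c∉Side₁ a∈₁

  Side₂⇒≢c : ∀ {a} → Side₂ a → a ≢ c
  Side₂⇒≢c a∈₂ refl = c∉Side₂ a∈₂

-- 3-γt-edge-critical graphs with a cut vertex

module CriticalGraph {n} (G : Graph n)
  (no-dominating-pair : ∀ p q → ¬ Dominates (Adj G) p q)
  (dominating-pair⁺   : ∀ {u v} → u ≢ v → ¬ Adj G u v → ∃₂ (Dominates (Adj⁺ G u v)))
  (neighbour          : ∀ w → ∃ (Adj G w))
  (connected          : Connected G)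
  where

  open Adjacency G

  infix 4 _∼_ _≁_
  _∼_ _≁_ : Fin n → Fin n → Set
  a ∼ b = Adj G a b
  a ≁ b = ¬ a ∼ b

  dominated-by-partner : ∀ {u v p q} → u ≢ v → Dominates (Adj⁺ G u v) p q → Adj⁺ G u v p q
  dominated-by-partner {p = p} u≢v dom = [ ⊥-elim ∘ Adj⁺-irrefl u≢v , id ] (dom p)

  dominates-partner : ∀ {u v p q} → u ≢ v → Dominates (Adj⁺ G u v) p q → Adj⁺ G u v q p
  dominates-partner {u} {v} u≢v = dominated-by-partner u≢v ∘ Dominates-swap {R = Adj⁺ G u v}

  dominating-pair-through : ∀ {u v} → u ≢ v → u ≁ v → ∀ {w} → w ≢ u → w ≢ v →
                            ∃₂ λ p q → Dominates (Adj⁺ G u v) p q × w ∼ p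
  dominating-pair-through {u} {v} u≢v u≁v {w} w≢u w≢v
    with p , q , dom ← dominating-pair⁺ u≢v u≁v
    with r , s , dom′ , w∼⁺r ← Dominates-through {R = Adj⁺ G u v} dom w
    = r , s , dom′ , Adj⁺⇒Adjˡ w∼⁺r w≢u w≢v

  adjacent≢non-adjacent : ∀ {a b c} → a ∼ c → b ≁ c → a ≢ b
  adjacent≢non-adjacent a∼c b≁c refl = b≁c a∼c

  non-neighbours-not-dominated : ∀ {c p} → p ∼ c → ¬ (∀ {t} → t ≢ c → t ≁ c → t ∼ p)
  non-neighbours-not-dominated {c} {p} p∼c dominated = no-dominating-pair p c dom
    where
    dom : Dominates _∼_ p c
    dom t with t ≟ c | Adj? t c
    ... | yes refl | _        = inj₁ (Adj-sym p∼c)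
    ... | no _     | yes t∼c  = inj₂ t∼c
    ... | no t≢c   | no t≁c   = inj₁ (dominated t≢c t≁c)

  Dominates⁺⇒Dominates : ∀ {u v p q} → p ≢ u → p ≢ v → q ≢ u → q ≢ v →
                         Dominates (Adj⁺ G u v) p q → Dominates _∼_ p q
  Dominates⁺⇒Dominates p≢u p≢v q≢u q≢v dom =
    Sum.map (λ t∼⁺p → Adj⁺⇒Adjʳ t∼⁺p p≢u p≢v) (λ t∼⁺q → Adj⁺⇒Adjʳ t∼⁺q q≢u q≢v) ∘ dom

  pair⁺-meets-edge : ∀ {u v p q} → Dominates (Adj⁺ G u v) p q →
                     p ≢ u → p ≢ v → q ≢ u → q ≢ v → ⊥
  pair⁺-meets-edge {p = p} {q} dom p≢u p≢v q≢u q≢v =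
    no-dominating-pair p q (Dominates⁺⇒Dominates p≢u p≢v q≢u q≢v dom)

  module _ {c} (σ : Separation G c) where
    open Separation σ
    open SeparationProperties σ

    module _ {u v} (u∈₁ : Side₁ u) (v∈₂ : Side₂ v) where

      u≢v : u ≢ v
      u≢v = Side₁≢Side₂ u∈₁ v∈₂

      cross⁺ : ∀ {a b} → Side₁ a → Side₂ b → Adj⁺ G u v a b → a ≡ u × b ≡ v
      cross⁺ a∈₁ b∈₂ (inj₁ a∼b)             = ⊥-elim (no-cross-edge a∈₁ b∈₂ a∼b)
      cross⁺ a∈₁ b∈₂ (inj₂ (inj₁ a≡u,b≡v))  = a≡u,b≡v
      cross⁺ a∈₁ b∈₂ (inj₂ (inj₂ (refl , _))) = ⊥-elim (disjoint a∈₁ v∈₂)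

      cross⁺ᵀ : ∀ {a b} → Side₂ b → Side₁ a → Adj⁺ G u v b a → a ≡ u × b ≡ v
      cross⁺ᵀ b∈₂ a∈₁ = cross⁺ a∈₁ b∈₂ ∘ Adj⁺-sym

      pair-in-Side₁ : ∀ {p q z} → Dominates (Adj⁺ G u v) p q → Side₁ p → Side₁ q → Side₂ z → z ≡ v
      pair-in-Side₁ {z = z} dom p∈₁ q∈₁ z∈₂ =
        [ proj₂ ∘ cross⁺ᵀ z∈₂ p∈₁ , proj₂ ∘ cross⁺ᵀ z∈₂ q∈₁ ] (dom z)

      dominator-off-Side₁ : ∀ {p q v′} → Side₂ v′ → v′ ≢ v → u ≁ c →
                            Dominates (Adj⁺ G u v) p q → c ∼ p → ¬ Side₁ p
      dominator-off-Side₁ {p} {q} v′∈₂ v′≢v u≁c dom c∼p p∈₁ with q ≟ u | q ≟ v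
      ... | yes refl | _        = v′≢v (pair-in-Side₁ dom p∈₁ u∈₁ v′∈₂)
      ... | no _     | yes refl = p≢u (proj₁ (cross⁺ p∈₁ v∈₂ (dominated-by-partner u≢v dom)))
        where p≢u = adjacent≢non-adjacent (Adj-sym c∼p) u≁c
      ... | no q≢u   | no q≢v   = pair⁺-meets-edge dom p≢u (Side₁≢Side₂ p∈₁ v∈₂) q≢u q≢v
        where p≢u = adjacent≢non-adjacent (Adj-sym c∼p) u≁c

      dominator-in-Side₂ : ∀ {p q u₁} → Side₁ u₁ → u₁ ≢ u → u₁ ≁ c →
                           Dominates (Adj⁺ G u v) p q → Side₂ p → q ≡ u × p ≡ v
      dominator-in-Side₂ {p} {q} {u₁} u₁∈₁ u₁≢u u₁≁c dom p∈₂ with dom u₁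
      ... | inj₁ u₁∼⁺p = contradiction (proj₁ (cross⁺ u₁∈₁ p∈₂ u₁∼⁺p)) u₁≢u
      ... | inj₂ u₁∼⁺q = cross⁺ q∈₁ p∈₂ (dominates-partner u≢v dom)
        where
        u₁∼q = Adj⁺⇒Adjˡ u₁∼⁺q u₁≢u (Side₁≢Side₂ u₁∈₁ v∈₂)
        q∈₁ = closed₁ u₁∈₁ u₁∼q λ { refl → u₁≁c u₁∼q }

      dominating-pair-at-cut : ∃₂ λ p q → Dominates (Adj⁺ G u v) p q × c ∼ p
      dominating-pair-at-cut = dominating-pair-through u≢v (no-cross-edge u∈₁ v∈₂)
        (λ c≡u → Side₁⇒≢c u∈₁ (sym c≡u)) (λ c≡v → Side₂⇒≢c v∈₂ (sym c≡v))

      Side₁-adjacent-to-non-neighbour : ∀ {u₁ v′ w} → u ≁ c → Side₁ u₁ → u₁ ≢ u → u₁ ≁ c →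
                                        Side₂ v′ → v′ ≢ v → Side₁ w → w ≢ u → ¬ w ≁ u
      Side₁-adjacent-to-non-neighbour {u₁} {v′} {w} u≁c u₁∈₁ u₁≢u u₁≁c v′∈₂ v′≢v w∈₁ w≢u w≁u
        with p , q , dom , c∼p ← dominating-pair-at-cut
        = covers (Adj⇒≢ c∼p ∘ sym)
            [ dominator-off-Side₁ v′∈₂ v′≢v u≁c dom c∼p , w-undominated ]
        where
        w-undominated : ¬ Side₂ p
        w-undominated p∈₂ with q≡u , p≡v ← dominator-in-Side₂ u₁∈₁ u₁≢u u₁≁c dom p∈₂ =
          [ (λ w∼⁺p → w≢u (proj₁ (cross⁺ w∈₁ v∈₂ (subst (Adj⁺ G u v w) p≡v w∼⁺p))))
          , (λ w∼⁺q → w≁u (Adj⁺⇒Adjˡ (subst (Adj⁺ G u v w) q≡u w∼⁺q) w≢u (Side₁≢Side₂ w∈₁ v∈₂)))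
          ] (dom w)

  non-neighbours-of-cut-on-one-side : ∀ {c} (σ : Separation G c) {u v} →
    Separation.Side₁ σ u → Separation.Side₂ σ v → u ≁ c → v ≁ c → ⊥
  non-neighbours-of-cut-on-one-side {c} σ {u} {v} u∈₁ v∈₂ u≁c v≁c
    with p , q , dom , c∼p ← dominating-pair-at-cut σ u∈₁ v∈₂
    with u′ , u∼u′ ← neighbour u
    with v′ , v∼v′ ← neighbour v
    = covers (Adj⇒≢ c∼p ∘ sym) [
        dominator-off-Side₁ σ u∈₁ v∈₂ (closed₂ v∈₂ v∼v′ λ { refl → v≁c v∼v′ })
          (Adj⇒≢ v∼v′ ∘ sym) u≁c dom c∼p
      , dominator-off-Side₁ (Separation-swap σ) v∈₂ u∈₁ (closed₁ u∈₁ u∼u′ λ { refl → u≁c u∼u′ })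
          (Adj⇒≢ u∼u′ ∘ sym) v≁c (Sum.map Adj⁺-swap Adj⁺-swap ∘ dom) c∼p ]
    where
    open Separation σ
    open SeparationProperties σ

  module _ {c} (σ : Separation G c) {u₀} (u₀∈₁ : Separation.Side₁ σ u₀) (u₀≁c : u₀ ≁ c) where
    open Separation σ
    open SeparationProperties σ

    Side₂⇒∼c : ∀ {v} → Side₂ v → v ∼ c
    Side₂⇒∼c {v} v∈₂ =
      decidable-stable (Adj? v c) (non-neighbours-of-cut-on-one-side σ u₀∈₁ v∈₂ u₀≁c)

    another-non-neighbour : ¬ ¬ (∃ λ u₁ → Side₁ u₁ × u₁ ≢ u₀ × u₁ ≁ c)
    another-non-neighbour k with any? (λ w → ¬? (w ≟ c) ×-dec ¬? (w ≟ u₀) ×-dec ¬? (Adj? w c))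
    ... | yes (u₁ , u₁≢c , u₁≢u₀ , u₁≁c) =
      covers u₁≢c [ (λ u₁∈₁ → k (u₁ , u₁∈₁ , u₁≢u₀ , u₁≁c)) , u₁≁c ∘ Side₂⇒∼c ]
    ... | no none = non-neighbours-not-dominated z∼c only-u₀
      where
      z = proj₁ (neighbour u₀)
      u₀∼z = proj₂ (neighbour u₀)
      z∼c : z ∼ c
      z∼c = decidable-stable (Adj? z c) λ z≁c →
              none (z , (λ { refl → u₀≁c u₀∼z }) , Adj⇒≢ u₀∼z ∘ sym , z≁c)
      only-u₀ : ∀ {t} → t ≢ c → t ≁ c → t ∼ z
      only-u₀ {t} t≢c t≁c = subst (_∼ z) u₀≡t u₀∼z
        where u₀≡t = decidable-stable (u₀ ≟ t) λ u₀≢t → none (t , t≢c , u₀≢t ∘ sym , t≁c)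

    Side₂-leaves : ∀ {u₁ w y} → Side₁ u₁ → u₁ ≢ u₀ → u₁ ≁ c → Side₁ w → w ∼ c →
                   Side₂ y → ∀ {z} → y ∼ z → z ≡ c
    Side₂-leaves {u₁} {w} {y} u₁∈₁ u₁≢u₀ u₁≁c w∈₁ w∼c y∈₂ {z} y∼z = decidable-stable (z ≟ c) λ z≢c →
      non-neighbours-not-dominated w∼c (λ t≢c t≁c → w-dominates (closed₂ y∈₂ y∼z z≢c) t≢c t≁c)
      where
      other-non-neighbour : ∀ t → ∃ λ o → Side₁ o × o ≢ t × o ≁ c
      other-non-neighbour t with u₀ ≟ t
      ... | yes refl  = u₁ , u₁∈₁ , u₁≢u₀ , u₁≁c
      ... | no u₀≢t   = u₀ , u₀∈₁ , u₀≢t , u₀≁c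
      w-dominates : Side₂ z → ∀ {t} → t ≢ c → t ≁ c → t ∼ w
      w-dominates z∈₂ {t} t≢c t≁c = decidable-stable (Adj? t w) λ t≁w → covers t≢c [
          (λ t∈₁ → let o , o∈₁ , o≢t , o≁c = other-non-neighbour t in
            Side₁-adjacent-to-non-neighbour σ t∈₁ y∈₂ t≁c o∈₁ o≢t o≁c z∈₂ (Adj⇒≢ y∼z ∘ sym) w∈₁
              (λ { refl → t≁c w∼c }) (t≁w ∘ Adj-sym))
        , t≁c ∘ Side₂⇒∼c ]

    leaf-on-Side₂ : ¬ ¬ Leaf G c
    leaf-on-Side₂ ¬leaf
      with y , y∈₂ ← inhabited₂
      with w , w∈₁ , w∼c ← closed-walk-reaches closed₁ u₀∈₁ c∉Side₁ (connected u₀ c)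
      = another-non-neighbour λ (u₁ , u₁∈₁ , u₁≢u₀ , u₁≁c) →
          ¬leaf (y , Side₂⇒∼c y∈₂ , Side₂-leaves u₁∈₁ u₁≢u₀ u₁≁c w∈₁ w∼c y∈₂)

  leaf-at-cut : ∀ {c} → CutVertex G c → ¬ ¬ Leaf G c
  leaf-at-cut {c} cut ¬leaf with any? (λ w → ¬? (w ≟ c) ×-dec ¬? (Adj? w c))
  ... | no none = non-neighbours-not-dominated (Adj-sym (proj₂ (neighbour c)))
                    λ t≢c t≁c → ⊥-elim (none (_ , t≢c , t≁c))
  ... | yes (w₀ , w₀≢c , w₀≁c) = Separation.covers σ w₀≢c [
          (λ w₀∈₁ → leaf-on-Side₂ σ w₀∈₁ w₀≁c ¬leaf)
        , (λ w₀∈₂ → leaf-on-Side₂ (Separation-swap σ) w₀∈₂ w₀≁c ¬leaf) ]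
    where
    σ = separation-at-cut cut

  module WithLeaf {c v} (v∼c : v ∼ c) (leaf : ∀ {z} → v ∼ z → z ≡ c) where

    Rest Near Far : Fin n → Set
    Rest w = w ≢ c × w ≢ v
    Near w = Rest w × w ∼ c
    Far  w = Rest w × w ≁ c

    Rest? : ∀ w → Dec (Rest w)
    Rest? w = ¬? (w ≟ c) ×-dec ¬? (w ≟ v)

    Near? : ∀ w → Dec (Near w)
    Near? w = Rest? w ×-dec Adj? w c

    Far? : ∀ w → Dec (Far w)
    Far? w = Rest? w ×-dec ¬? (Adj? w c)

    c≢v : c ≢ v
    c≢v = Adj⇒≢ (Adj-sym v∼c)

    ≢c⇒≁v : ∀ {w} → w ≢ c → w ≁ v
    ≢c⇒≁v w≢c w∼v = w≢c (leaf (Adj-sym w∼v))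

    ≁c⇒≢v : ∀ {w} → w ≁ c → w ≢ v
    ≁c⇒≢v w≁c refl = w≁c v∼c

    Rest-closed : ClosedAwayFrom G Rest c
    Rest-closed (x≢c , _) x∼y y≢c = y≢c , λ { refl → ≢c⇒≁v x≢c x∼y }

    -- A dominating pair of G + ab has to dominate the leaf v, so it contains c.
    pair-through-cut : ∀ {a b} → a ≢ v → b ≢ v → a ≢ b → a ≁ b → ∃ λ q → Dominates (Adj⁺ G a b) c q
    pair-through-cut a≢v b≢v a≢b a≁b
      with p , q , dom , v∼p ← dominating-pair-through a≢b a≁b (a≢v ∘ sym) (b≢v ∘ sym)
      with refl ← leaf v∼p
      = q , dom

    c∼partner : ∀ {a b q} → a ≢ b → a ≢ c → b ≢ c → Dominates (Adj⁺ G a b) c q → c ∼ q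
    c∼partner a≢b a≢c b≢c dom = Adj⁺⇒Adjˡ (dominated-by-partner a≢b dom) (a≢c ∘ sym) (b≢c ∘ sym)

    Far-dominated : ∀ {a b q} → a ≢ c → b ≢ c → Dominates (Adj⁺ G a b) c q →
                    ∀ {w} → Far w → Adj⁺ G a b w q
    Far-dominated a≢c b≢c dom {w} (_ , w≁c) =
      [ (λ w∼⁺c → ⊥-elim (w≁c (Adj⁺⇒Adjʳ w∼⁺c (a≢c ∘ sym) (b≢c ∘ sym)))) , id ] (dom w)

    ¬dominates-Far : ∀ {q} → q ∼ c → ¬ (∀ {w} → Far w → w ∼ q)
    ¬dominates-Far q∼c dominated =
      non-neighbours-not-dominated q∼c λ t≢c t≁c → dominated ((t≢c , ≁c⇒≢v t≁c) , t≁c)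

    Far-clique : ∀ {a b} → Far a → Far b → a ≢ b → a ∼ b
    Far-clique {a} {b} ((a≢c , a≢v) , a≁c) ((b≢c , b≢v) , b≁c) a≢b with Adj? a b
    ... | yes a∼b = a∼b
    ... | no a≁b
      with q , dom ← pair-through-cut a≢v b≢v a≢b a≁b
      = ⊥-elim (pair⁺-meets-edge dom (a≢c ∘ sym) (b≢c ∘ sym)
                 (adjacent≢non-adjacent (Adj-sym c∼q) a≁c)
                 (adjacent≢non-adjacent (Adj-sym c∼q) b≁c))
      where c∼q = c∼partner a≢b a≢c b≢c dom

    Near-clique : ∀ {a b} → Near a → Near b → a ≢ b → a ∼ b
    Near-clique {a} {b} ((a≢c , a≢v) , a∼c) ((b≢c , b≢v) , b∼c) a≢b with Adj? a b
    ... | yes a∼b = a∼b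
    ... | no a≁b
      with q , dom ← pair-through-cut a≢v b≢v a≢b a≁b
      = ⊥-elim (¬dominates-Far (Adj-sym (c∼partner a≢b a≢c b≢c dom)) λ { far-w@(_ , w≁c) →
          Adj⁺⇒Adjˡ (Far-dominated a≢c b≢c dom far-w)
                    (adjacent≢non-adjacent a∼c w≁c ∘ sym) (adjacent≢non-adjacent b∼c w≁c ∘ sym) })

    Near-has-one-Far-non-neighbour : ∀ {x y y′} → Near x → Far y → Far y′ → x ≁ y → x ≁ y′ → y ≡ y′
    Near-has-one-Far-non-neighbour {x} {y} {y′}
      ((x≢c , x≢v) , x∼c) ((y≢c , y≢v) , y≁c) far-y′ x≁y x≁y′ with y ≟ y′
    ... | yes y≡y′ = y≡y′
    ... | no y≢y′
      with q , dom ← pair-through-cut x≢v y≢v (adjacent≢non-adjacent x∼c y≁c) x≁y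
      with q ≟ x
    ... | yes refl = ⊥-elim (x≁y′ (Adj-sym y′∼q))
      where
      y′∼q = Adj⁺⇒Adjˡ (Far-dominated x≢c y≢c dom far-y′)
                       (adjacent≢non-adjacent x∼c (proj₂ far-y′) ∘ sym) (y≢y′ ∘ sym)
    ... | no q≢x =
      ⊥-elim (pair⁺-meets-edge dom (x≢c ∘ sym) (y≢c ∘ sym) q≢x (adjacent≢non-adjacent (Adj-sym c∼q) y≁c))
      where c∼q = c∼partner (adjacent≢non-adjacent x∼c y≁c) x≢c y≢c dom

    Far-inhabited : ∃ Far
    Far-inhabited with any? Far?
    ... | yes found = found
    ... | no none   = ⊥-elim (non-neighbours-not-dominated v∼c λ t≢c t≁c →
                        ⊥-elim (none (_ , (t≢c , ≁c⇒≢v t≁c) , t≁c)))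

    another-Far : ∀ {y} → Far y → ∃ λ y′ → Far y′ × y′ ≢ y
    another-Far {y} ((y≢c , _) , y≁c) with any? (λ w → Far? w ×-dec ¬? (w ≟ y))
    ... | yes found = found
    ... | no none
      with z , y∼z ← neighbour y
      = ⊥-elim (¬dominates-Far z∼c λ far-w → subst (_∼ z) (only-y far-w) y∼z)
      where
      only-y : ∀ {w} → Far w → y ≡ w
      only-y {w} far-w = decidable-stable (y ≟ w) λ y≢w → none (w , far-w , y≢w ∘ sym)
      z∼c : z ∼ c
      z∼c = decidable-stable (Adj? z c) λ z≁c →
              none (z , ((z≢c , ≁c⇒≢v z≁c) , z≁c) , Adj⇒≢ y∼z ∘ sym)
        where z≢c = λ z≡c → y≁c (subst (y ∼_) z≡c y∼z)

    Near-inhabited : ∃ Near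
    Near-inhabited
      with y , (rest-y , _) ← Far-inhabited
      with w , rest-w , w∼c ←
             closed-walk-reaches Rest-closed rest-y (λ (c≢c , _) → c≢c refl) (connected y c)
      = w , rest-w , w∼c

    pair⁺-at-leaf-edge-impossible : ∀ {x y y′ r s} → Near x → Far y → y ≁ x → Far y′ → y′ ≢ y →
      Dominates (Adj⁺ G v y) r s → r ≡ c ⊎ r ≡ y → s ≡ v ⊎ s ≡ x → ⊥
    pair⁺-at-leaf-edge-impossible {x} {y} {y′}
      ((x≢c , x≢v) , x∼c) ((y≢c , y≢v) , y≁c) y≁x ((y′≢c , y′≢v) , y′≁c) y′≢y dom = λ where
        (inj₁ refl) (inj₁ refl) → [ y′≁c ∘ y′-adj , ≢c⇒≁v y′≢c ∘ y′-adj ] (dom y′)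
        (inj₁ refl) (inj₂ refl) → [ y≁c ∘ y-adj c≢v (y≢c ∘ sym) , y≁x ∘ y-adj x≢v x≢y ] (dom y)
        (inj₂ refl) (inj₁ refl) → [ y≁x ∘ Adj-sym ∘ x-adj , ≢c⇒≁v x≢c ∘ x-adj ] (dom x)
        (inj₂ refl) (inj₂ refl) → [ Adj⁺-irrefl (y≢v ∘ sym) , y≁x ∘ y-adj x≢v x≢y ] (dom y)
      where
      x≢y : x ≢ y
      x≢y refl = y≁c x∼c
      y′-adj : ∀ {t} → Adj⁺ G v y y′ t → y′ ∼ t
      y′-adj y′∼⁺t = Adj⁺⇒Adjˡ y′∼⁺t y′≢v y′≢y
      x-adj : ∀ {t} → Adj⁺ G v y x t → x ∼ t
      x-adj x∼⁺t = Adj⁺⇒Adjˡ x∼⁺t x≢v x≢y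
      y-adj : ∀ {t} → t ≢ v → t ≢ y → Adj⁺ G v y y t → y ∼ t
      y-adj t≢v t≢y y∼⁺t = Adj⁺⇒Adjʳ y∼⁺t t≢v t≢y

    -- If x were the only Near vertex, take a Far y missing x and a dominating pair {r, s} of
    -- G + vy: r dominates v, so r ∈ {c, y}, and s dominates c, so s ∈ {v, x}; no choice works.
    single-Near-impossible : ∀ {x} → Near x → ¬ (∀ {w} → Near w → w ≡ x)
    single-Near-impossible {x} near-x@(_ , x∼c) only-x with any? (λ y → Far? y ×-dec ¬? (Adj? y x))
    ... | no none = ¬dominates-Far x∼c λ {w} far-w →
                      decidable-stable (Adj? w x) λ w≁x → none (w , far-w , w≁x)
    ... | yes (y , far-y@((y≢c , y≢v) , y≁c) , y≁x)
      with y′ , far-y′ , y′≢y ← another-Far far-y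
      with p , q , dom ← dominating-pair⁺ (y≢v ∘ sym) (y≢c ∘ leaf)
      with r , s , dom′ , v∼⁺r ← Dominates-through {R = Adj⁺ G v y} dom v
      = pair⁺-at-leaf-edge-impossible near-x far-y y≁x far-y′ y′≢y dom′ r∈c,y (c-neighbour c∼s)
      where
      r∈c,y : r ≡ c ⊎ r ≡ y
      r∈c,y = [ inj₁ ∘ leaf , [ inj₂ ∘ proj₂ , (λ (v≡y , _) → ⊥-elim (y≢v (sym v≡y))) ] ] v∼⁺r
      c∼s : c ∼ s
      c∼s = Adj⁺⇒Adjˡ ([ ⊥-elim ∘ c≁⁺r , id ] (dom′ c)) c≢v (y≢c ∘ sym)
        where
        c≁⁺r : ¬ Adj⁺ G v y c r
        c≁⁺r c∼⁺r = [ (λ r≡c → Adj⁺-irrefl (y≢v ∘ sym) (subst (Adj⁺ G v y c) r≡c c∼⁺r))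
                    , (λ r≡y → y≁c (Adj-sym (Adj⁺⇒Adjˡ (subst (Adj⁺ G v y c) r≡y c∼⁺r) c≢v (y≢c ∘ sym))))
                    ] r∈c,y
      c-neighbour : ∀ {t} → c ∼ t → t ≡ v ⊎ t ≡ x
      c-neighbour {t} c∼t with t ≟ v
      ... | yes t≡v = inj₁ t≡v
      ... | no t≢v  = inj₂ (only-x ((Adj⇒≢ c∼t ∘ sym , t≢v) , Adj-sym c∼t))

    another-Near : ∀ {x} → Near x → ∃ λ x′ → Near x′ × x′ ≢ x
    another-Near {x} near-x with any? (λ w → Near? w ×-dec ¬? (w ≟ x))
    ... | yes found = found
    ... | no none   = ⊥-elim (single-Near-impossible near-x λ {w} near-w →
                        decidable-stable (w ≟ x) λ w≢x → none (w , near-w , w≢x))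

    data Position : Fin n → Set where
      at-cut  : Position c
      at-leaf : Position v
      near    : ∀ {w} → Near w → Position w
      far     : ∀ {w} → Far w → Position w

    position : ∀ w → Position w
    position w with w ≟ c | w ≟ v | Adj? w c
    ... | yes refl | _        | _       = at-cut
    ... | no _     | yes refl | _       = at-leaf
    ... | no w≢c   | no w≢v   | yes w∼c = near ((w≢c , w≢v) , w∼c)
    ... | no w≢c   | no w≢v   | no w≁c  = far ((w≢c , w≢v) , w≁c)

    -- Each non-edge of G is charged to an endpoint in Rest: the non-edges at v and at c to their
    -- other endpoint, and a non-edge between Near and Far to its Near endpoint.
    Charged′ Charged : Fin n → Fin n → Set
    Charged′ i j = (Far i × j ≡ c) ⊎ (Near i × Far j × i ≁ j)
    Charged  i j = (Rest i × j ≡ v) ⊎ Charged′ i j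

    Charged′? : ∀ i j → Dec (Charged′ i j)
    Charged′? i j = (Far? i ×-dec j ≟ c) ⊎-dec (Near? i ×-dec Far? j ×-dec ¬? (Adj? i j))

    Charged? : ∀ i j → Dec (Charged i j)
    Charged? i j = (Rest? i ×-dec j ≟ v) ⊎-dec Charged′? i j

    non-edge-charged : ∀ {i j} → i ≢ j → i ≁ j → Charged i j ⊎ Charged j i
    non-edge-charged {i} {j} i≢j i≁j with position i | position j
    ... | at-cut          | at-cut          = ⊥-elim (i≢j refl)
    ... | at-cut          | at-leaf         = ⊥-elim (i≁j (Adj-sym v∼c))
    ... | at-cut          | near (_ , j∼c)  = ⊥-elim (i≁j (Adj-sym j∼c))
    ... | at-cut          | far far-j       = inj₂ (inj₂ (inj₁ (far-j , refl)))
    ... | at-leaf         | at-cut          = ⊥-elim (i≁j v∼c)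
    ... | at-leaf         | at-leaf         = ⊥-elim (i≢j refl)
    ... | at-leaf         | near (rest-j , _) = inj₂ (inj₁ (rest-j , refl))
    ... | at-leaf         | far (rest-j , _)  = inj₂ (inj₁ (rest-j , refl))
    ... | near (_ , i∼c)  | at-cut          = ⊥-elim (i≁j i∼c)
    ... | near (rest-i , _) | at-leaf       = inj₁ (inj₁ (rest-i , refl))
    ... | near near-i     | near near-j     = ⊥-elim (i≁j (Near-clique near-i near-j i≢j))
    ... | near near-i     | far far-j       = inj₁ (inj₂ (inj₂ (near-i , far-j , i≁j)))
    ... | far far-i       | at-cut          = inj₁ (inj₂ (inj₁ (far-i , refl)))
    ... | far (rest-i , _) | at-leaf        = inj₁ (inj₁ (rest-i , refl))
    ... | far far-i       | near near-j     = inj₂ (inj₂ (inj₂ (near-j , far-i , i≁j ∘ Adj-sym)))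
    ... | far far-i       | far far-j       = ⊥-elim (i≁j (Far-clique far-i far-j i≢j))

    Charged′-unique : ∀ {i j j′} → Charged′ i j → Charged′ i j′ → j ≡ j′
    Charged′-unique (inj₁ (_ , refl))           (inj₁ (_ , refl))           = refl
    Charged′-unique (inj₁ ((_ , i≁c) , _))      (inj₂ ((_ , i∼c) , _))      = contradiction i∼c i≁c
    Charged′-unique (inj₂ ((_ , i∼c) , _))      (inj₁ ((_ , i≁c) , _))      = contradiction i∼c i≁c
    Charged′-unique (inj₂ (near-i , far-j , i≁j)) (inj₂ (_ , far-j′ , i≁j′)) =
      Near-has-one-Far-non-neighbour near-i far-j far-j′ i≁j i≁j′

    Charged⇒Rest : ∀ {i j} → Charged i j → Rest i
    Charged⇒Rest = [ proj₁ , [ proj₁ ∘ proj₁ , proj₁ ∘ proj₁ ] ]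

    count-Charged : ∀ i → count (Charged? i) ≤ 𝟙 (Rest? i) + 𝟙 (Rest? i)
    count-Charged i = bound (Rest? i)
      where
      bound : (rest? : Dec (Rest i)) → count (Charged? i) ≤ 𝟙 rest? + 𝟙 rest?
      bound (yes _)    = ℕ.≤-trans (count-⊎ (Charged? i) (_≟ v) (Charged′? i) (Sum.map₁ proj₂))
                           (ℕ.+-mono-≤ (count-≤1 (_≟ v) λ { refl refl → refl })
                                       (count-≤1 (Charged′? i) Charged′-unique))
      bound (no ¬rest) = ℕ.≤-reflexive (count-none (Charged? i) λ _ → ¬rest ∘ Charged⇒Rest)

    count-Rest+2≤n : count Rest? + 2 ≤ n
    count-Rest+2≤n = begin
      count Rest? + 2
        ≤⟨ ℕ.+-monoʳ-≤ (count Rest?) (count-≥2 c-or-v? (inj₁ refl) (inj₂ refl) c≢v) ⟩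
      count Rest? + count c-or-v?
        ≤⟨ count-disjoint Rest? c-or-v? everything? _ _ (λ (w≢c , w≢v) → [ w≢c , w≢v ]) ⟩
      count everything?
        ≡⟨ count-full everything? _ ⟩
      n ∎
      where
      open ℕ.≤-Reasoning
      c-or-v? : ∀ w → Dec (w ≡ c ⊎ w ≡ v)
      c-or-v? w = w ≟ c ⊎-dec w ≟ v
      everything? : ∀ (w : Fin n) → Dec ⊤
      everything? _ = yes tt

    4≤count-Rest : 4 ≤ count Rest?
    4≤count-Rest
      with x , near-x ← Near-inhabited
      with x′ , near-x′ , x′≢x ← another-Near near-x
      with y , far-y ← Far-inhabited
      with y′ , far-y′ , y′≢y ← another-Far far-y
      = ℕ.≤-trans (ℕ.+-mono-≤ (count-≥2 Near? near-x′ near-x x′≢x)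
                              (count-≥2 Far? far-y′ far-y y′≢y))
                  (count-disjoint Near? Far? Rest? proj₁ proj₁ λ (_ , w∼c) (_ , w≁c) → w≁c w∼c)

    complementEdgeCount≤2∣Rest∣ : complementEdgeCount G ≤ count Rest? + count Rest?
    complementEdgeCount≤2∣Rest∣ = begin
      complementEdgeCount G                    ≡⟨ complementEdgeCount≡∑ G ⟩
      ∑[ i < n ] count (NonEdge? G i)          ≤⟨ count-oriented (λ i j → ¬? (Adj? i j)) Charged? (λ i<j →
                                                    non-edge-charged λ { refl → ℕ.<-irrefl refl i<j }) ⟩
      ∑[ i < n ] count (Charged? i)            ≤⟨ ∑-mono-≤ count-Charged ⟩
      ∑[ i < n ] (𝟙 (Rest? i) + 𝟙 (Rest? i))   ≡⟨ ∑-distrib-+ (𝟙 ∘ Rest?) (𝟙 ∘ Rest?) ⟩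
      count Rest? + count Rest?                ∎
      where open ℕ.≤-Reasoning

    complementEdgeCount<n²/4 : complementEdgeCount G < n * n / 4
    complementEdgeCount<n²/4 = ≤2a⇒<n²/4 complementEdgeCount≤2∣Rest∣ count-Rest+2≤n 4≤count-Rest

mainTheorem2 : (n : ℕ) (G : Graph n) → ThreeTotalEdgeCritical G → ConnectivityOne G →
    complementEdgeCount G < (n * n) / 4
mainTheorem2 zero    G _ (_ , () , _)
mainTheorem2 (suc n) G (γt≡3 , _) (_ , _ , inj₂ refl) =
  ⊥-elim (ℕ.<⇒≱ (s≤s (s≤s (s≤s z≤n))) (γt≡k⇒k≤n G γt≡3))
mainTheorem2 (suc n) G critical@(γt≡3 , _) (connected , _ , inj₁ (c , cut)) =
  decidable-stable (_ ℕ.<? _) λ ¬bound →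
    leaf-at-cut cut λ (v , v∼c , leaf) → ¬bound (WithLeaf.complementEdgeCount<n²/4 v∼c leaf)
  where
  open CriticalGraph G (γt≡3⇒¬Dominates G γt≡3) (critical⇒Dominates⁺ {G = G} critical)
                       (γt≡k⇒neighbour G γt≡3) connected
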